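{- Let $T$ be any irreducible, optimal two-way-comparison search tree for an instance $(\mathcal K,\mathcal Q,\mathcal C,\alpha,\beta)$ with $\mathcal C\subseteq\{<,\le,=\}$. If an internal node of $T$ with comparison "$v=K_a$" is an ancestor of an internal node with comparison "$v=K_z$", then $\beta_a\ge\beta_z$.
   Context: An instance is $(\mathcal K,\mathcal Q,\mathcal C,\alpha,\beta)$: real keys $\mathcal K=\{K_1<\dots<K_n\}$, queries $\mathcal Q\subseteq\mathbb R$, allowed operators $\mathcal C$, and a probability distribution on $\mathcal Q$ with $\beta_i=\Pr[v=K_i]$, $\alpha_i=\Pr[K_i<v<K_{i+1}]$. A two-way-comparison search tree is a rooted binary tree whose internal nodes are labeled by comparisons "$v\ \mathrm{op}\ K_i$", $\mathrm{op}\in\mathcal C$, with yes/no children; queries are routed from the root to a leaf. It is correct if for every leaf all queries reaching it have the same relation ($<,=,>$) to every key; its cost is the expected number of comparisons on a random query, and it is optimal if correct and of minimum cost. For a node $N$, $\mathcal Q(N)$ is the set of queries whose search reaches $N$; the tree is irreducible if $\mathcal Q(N)\ne\mathcal Q(N')$ for every node $N$ with parent $N'$. -}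

module Defs where

open import Level using (Level; _⊔_) renaming (suc to lsuc)
open import Data.Nat using (ℕ; zero; suc; _≤ᵇ_; _<ᵇ_; _≡ᵇ_)
open import Data.Fin using (Fin; toℕ)
open import Data.Bool using (Bool; true; false; if_then_else_)
open import Data.List using (List; []; _∷_; _++_; map; foldr)
open import Data.List.Base using (allFin)
open import Data.Product using (_×_)
open import Data.Empty using (⊥)
open import Relation.Binary using (Rel; IsTotalOrder)
open import Relation.Binary.PropositionalEquality using (_≡_)
open import Algebra.Bundles using (CommutativeRing)

-- Weights (probabilities) live in an arbitrary (totally) ordered
-- commutative ring; the real numbers are an instance.

record OrderedCommRing (c ℓ₁ ℓ₂ : Level) : Set (lsuc (c ⊔ ℓ₁ ⊔ ℓ₂)) where
  field
    commutativeRing : CommutativeRing c ℓ₁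
  open CommutativeRing commutativeRing public
  field
    _≤_          : Rel Carrier ℓ₂
    isTotalOrder : IsTotalOrder _≈_ _≤_
    +-mono-≤     : ∀ {x y} z → x ≤ y → (x + z) ≤ (y + z)
    *-nonneg     : ∀ {x y} → 0# ≤ x → 0# ≤ y → 0# ≤ (x * y)

-- Keys K_1 < ... < K_n are indexed (0-based) by Fin n.
-- Every real query v has a fixed relation to all keys, determined by
-- the "region" it lies in:
--   key j : v = K_{j+1}
--   gap i : K_i < v < K_{i+1}   (i = 0..n, K_0 = -∞, K_{n+1} = +∞)
-- Comparisons only depend on the region, so a query set Q ⊆ ℝ and a
-- distribution on it are represented by a predicate on regions
-- (which regions contain some query) and a weight per region
-- (β_j = weight (key j), α_i = weight (gap i)).

data Region (n : ℕ) : Set where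
  gap : Fin (suc n) → Region n
  key : Fin n → Region n

allRegions : (n : ℕ) → List (Region n)
allRegions n = map gap (allFin (suc n)) ++ map key (allFin n)

data Rel3 : Set where
  below equal above : Rel3

relation : ∀ {n} → Region n → Fin n → Rel3
relation (gap i) j = if toℕ i ≤ᵇ toℕ j then below else above
relation (key k) j =
  if toℕ k <ᵇ toℕ j then below else (if toℕ k ≡ᵇ toℕ j then equal else above)

data Op : Set where
  op< op≤ op= : Op

holds : ∀ {n} → Op → Fin n → Region n → Bool
holds op< j r with relation r j
... | below = true
... | equal = false
... | above = false
holds op≤ j r with relation r j
... | below = true
... | equal = true
... | above = false
holds op= j r with relation r j
... | below = false
... | equal = true
... | above = false

-- Two-way-comparison search trees: node op j yes no  is "v op K_j".

data Tree (n : ℕ) : Set where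
  leaf : Tree n
  node : Op → Fin n → Tree n → Tree n → Tree n

data UsesOnly {n} (C : Op → Set) : Tree n → Set where
  leaf : UsesOnly C leaf
  node : ∀ {o j y m} → C o → UsesOnly C y → UsesOnly C m → UsesOnly C (node o j y m)

-- nodes are addressed by paths (true = yes-branch, false = no-branch)
data _at_≡_ {n} : Tree n → List Bool → Tree n → Set where
  here : ∀ {T} → T at [] ≡ T
  yes  : ∀ {o j y m p S} → y at p ≡ S → node o j y m at (true ∷ p) ≡ S
  no   : ∀ {o j y m p S} → m at p ≡ S → node o j y m at (false ∷ p) ≡ S

data Passes {n} : Tree n → Region n → List Bool → Set where
  here : ∀ {T r} → Passes T r []
  yes  : ∀ {o j y m r p} → holds o j r ≡ true  → Passes y r p → Passes (node o j y m) r (true ∷ p)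
  no   : ∀ {o j y m r p} → holds o j r ≡ false → Passes m r p → Passes (node o j y m) r (false ∷ p)

QAt : ∀ {n} → (Region n → Set) → Tree n → List Bool → Region n → Set
QAt Q T p r = Q r × Passes T r p

Correct : ∀ {n} → (Region n → Set) → Tree n → Set
Correct {n} Q T = ∀ p r s → T at p ≡ leaf → QAt Q T p r → QAt Q T p s →
                  ∀ j → relation r j ≡ relation s j

Irreducible : ∀ {n} → (Region n → Set) → Tree n → Set
Irreducible {n} Q T = ∀ p b S → T at (p ++ (b ∷ [])) ≡ S →
  (∀ r → (QAt Q T (p ++ (b ∷ [])) r → QAt Q T p r) × (QAt Q T p r → QAt Q T (p ++ (b ∷ [])) r)) →
  ⊥

depth : ∀ {n} → Tree n → Region n → ℕ
depth leaf r = 0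
depth (node o j y m) r = if holds o j r then suc (depth y r) else suc (depth m r)

module WithWeights {c ℓ₁ ℓ₂} (F : OrderedCommRing c ℓ₁ ℓ₂) where
  open OrderedCommRing F

  _·_ : ℕ → Carrier → Carrier
  zero  · x = 0#
  suc k · x = x + (k · x)

  Σ : ∀ {A : Set} → List A → (A → Carrier) → Carrier
  Σ xs f = foldr (λ a acc → f a + acc) 0# xs

  record Distribution {n} (Q : Region n → Set) (w : Region n → Carrier) : Set (c ⊔ ℓ₁ ⊔ ℓ₂) where
    field
      nonneg  : ∀ r → 0# ≤ w r
      support : ∀ r → (Q r → ⊥) → w r ≈ 0#
      total   : Σ (allRegions n) w ≈ 1#

  cost : ∀ {n} → (Region n → Carrier) → Tree n → Carrier
  cost {n} w T = Σ (allRegions n) (λ r → depth T r · w r)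

  Optimal : ∀ {n} → (Op → Set) → (Region n → Set) → (Region n → Carrier) → Tree n → Set ℓ₂
  Optimal C Q w T = UsesOnly C T × Correct Q T ×
    (∀ (T' : Tree _) → UsesOnly C T' → Correct Q T' → cost w T ≤ cost w T')

module Submission where

-- Let "v = K_a" (at path p) be a proper ancestor of "v = K_z", z ≠ a.  By
-- irreducibility K_z reaches "v = K_z", so it answers no at "v = K_a" and
-- walks down the no-subtree Na.  Let (o,j) be the first comparison on this
-- walk separating K_a from K_z ("v = K_z" itself does).  Put (o,j) in place
-- of "v = K_a"; below it, K_a's side gets the walk, then "v = K_a", then
-- K_a's subtree, and K_z's side gets the walk, then K_z's subtree, each side
-- keeping only the walk comparisons at which one of its regions leaves the
-- walk.  All comparisons are threshold or point tests on the line of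
-- regions, so no walk comparison is kept on both sides: if K_a gets D ≥ 1
-- comparisons deeper, K_z gets D shallower and nobody else gets deeper.
-- Optimality of T gives D·β_z ≤ D·β_a, so β_z ≤ β_a.

open import Defs
open import Level using (Level)
open import Function using (_∘_; id)
open import Data.Nat using (ℕ; zero; suc; _+_; _≤_; _<_; z≤n; s≤s; _≤ᵇ_; _<ᵇ_; _≡ᵇ_)
open import Data.Nat.Properties
  using (_<?_; _≟_; <ᵇ-reflects-<; suc-injective; ≤-refl; ≤-trans; ≤-reflexive; <-trans; <-≤-trans; <⇒≢; ≮⇒≥;
         n≤1+n; m≤n+m; +-mono-≤; module ≤-Reasoning)
import Data.Nat.Properties as ℕₚ
open import Algebra.Properties.CommutativeSemigroup ℕₚ.+-commutativeSemigroup
  using () renaming (interchange to +-interchange)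
open import Data.Fin using (Fin; toℕ)
import Data.Fin as Fin
open import Data.Fin.Properties using (toℕ-injective) renaming (suc-injective to Fin-suc-injective; _≟_ to _≟ᶠ_)
open import Data.Bool using (Bool; true; false; not; if_then_else_)
open import Data.Bool.Properties using (¬-not; not-¬) renaming (_≟_ to _≟ᵇ_)
open import Data.List using (List; []; _∷_; _++_; map; allFin; tabulate)
open import Data.List.Relation.Unary.Any using (Any; any?; satisfied)
open import Data.List.Membership.Propositional using (_∈_; lose)
open import Data.List.Membership.Propositional.Properties using (∈-++⁺ˡ; ∈-++⁺ʳ; ∈-map⁺; ∈-allFin)
open import Data.List.Properties using (∷-injectiveˡ; ∷-injectiveʳ; ++-identityʳ)
open import Data.Product using (_×_; _,_; proj₁; proj₂; ∃)
open import Data.Sum using (_⊎_; inj₁; inj₂)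
open import Data.Empty using (⊥-elim)
open import Relation.Nullary using (¬_; Dec; does; proof; ¬?; contradiction)
  renaming (yes to accept; no to reject)
open import Relation.Nullary.Reflects using (Reflects; ofʸ; ofⁿ)
open import Relation.Nullary.Decidable using (_×-dec_; dec-true; dec-false; map′)
open import Relation.Unary using (Decidable)
open import Relation.Binary using (IsTotalOrder)
open import Relation.Binary.PropositionalEquality
  using (_≡_; _≢_; refl; sym; trans; cong; cong₂; subst)

-- Comparisons as tests on positions.  Region gap i sits at position 2i
-- and key k at 2k+1, so the regions are ordered along ℕ.

twice : ℕ → ℕ
twice zero    = zero
twice (suc k) = suc (suc (twice k))

pos : ∀ {n} → Region n → ℕ
pos (gap i) = twice (toℕ i)
pos (key k) = suc (twice (toℕ k))

data Test : Set where
  lessThan equalTo : ℕ → Test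

accepts : Test → ℕ → Bool
accepts (lessThan c) x = x <ᵇ c
accepts (equalTo c)  x = x ≡ᵇ c

≡ᵇ-reflects-≡ : ∀ x c → Reflects (x ≡ c) (x ≡ᵇ c)
≡ᵇ-reflects-≡ x c = proof (x ≟ c)

testAt : Op → ℕ → Test
testAt op< j = lessThan (suc (twice j))
testAt op≤ j = lessThan (suc (suc (twice j)))
testAt op= j = equalTo (suc (twice j))

outcome : Op → Rel3 → Bool
outcome op< below = true
outcome op< equal = false
outcome op< above = false
outcome op≤ below = true
outcome op≤ equal = true
outcome op≤ above = false
outcome op= below = false
outcome op= equal = true
outcome op= above = false

holds-outcome : ∀ {n} o (j : Fin n) r → holds o j r ≡ outcome o (relation r j)
holds-outcome op< j r with relation r j
... | below = refl
... | equal = refl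
... | above = refl
holds-outcome op≤ j r with relation r j
... | below = refl
... | equal = refl
... | above = refl
holds-outcome op= j r with relation r j
... | below = refl
... | equal = refl
... | above = refl

accepts-shift : ∀ o j x → accepts (testAt o j) x ≡ accepts (testAt o (suc j)) (suc (suc x))
accepts-shift op< j x = refl
accepts-shift op≤ j x = refl
accepts-shift op= j x = refl

suc-≤ᵇ : ∀ i j → (suc i ≤ᵇ suc j) ≡ (i ≤ᵇ j)
suc-≤ᵇ zero    j = refl
suc-≤ᵇ (suc i) j = refl

gap-outcome : ∀ o i j →
  outcome o (if i ≤ᵇ j then below else above) ≡ accepts (testAt o j) (twice i)
gap-outcome op< zero    j       = refl
gap-outcome op≤ zero    j       = refl
gap-outcome op= zero    j       = refl
gap-outcome op< (suc i) zero    = refl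
gap-outcome op≤ (suc i) zero    = refl
gap-outcome op= (suc i) zero    = refl
gap-outcome o   (suc i) (suc j) rewrite suc-≤ᵇ i j =
  trans (gap-outcome o i j) (accepts-shift o j (twice i))

key-outcome : ∀ o k j →
  outcome o (if k <ᵇ j then below else (if k ≡ᵇ j then equal else above))
    ≡ accepts (testAt o j) (suc (twice k))
key-outcome op< zero    zero    = refl
key-outcome op≤ zero    zero    = refl
key-outcome op= zero    zero    = refl
key-outcome op< zero    (suc j) = refl
key-outcome op≤ zero    (suc j) = refl
key-outcome op= zero    (suc j) = refl
key-outcome op< (suc k) zero    = refl
key-outcome op≤ (suc k) zero    = refl
key-outcome op= (suc k) zero    = refl
key-outcome o   (suc k) (suc j) =
  trans (key-outcome o k j) (accepts-shift o j (suc (twice k)))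

holds-accepts : ∀ {n} o (j : Fin n) r → holds o j r ≡ accepts (testAt o (toℕ j)) (pos r)
holds-accepts o j (gap i) = trans (holds-outcome o j (gap i)) (gap-outcome o (toℕ i) (toℕ j))
holds-accepts o j (key k) = trans (holds-outcome o j (key k)) (key-outcome o (toℕ k) (toℕ j))

-- The answer of a test on positions below every position it separates.
acceptsLow : Test → Bool
acceptsLow (lessThan _) = true
acceptsLow (equalTo _)  = false

separator-above : ∀ t {x y u} → accepts t x ≢ accepts t y → x < u → y < u → accepts t u ≡ false
separator-above (lessThan c) {x} {y} {u} sep x<u y<u with u <ᵇ c | <ᵇ-reflects-< u c
... | false | ofⁿ _   = refl
... | true  | ofʸ u<c =
  contradiction (trans (dec-true (x <? c) (<-trans x<u u<c)) (sym (dec-true (y <? c) (<-trans y<u u<c)))) sep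
separator-above (equalTo c) {x} {y} {u} sep x<u y<u with u ≡ᵇ c | ≡ᵇ-reflects-≡ u c
... | false | ofⁿ _    = refl
... | true  | ofʸ refl =
  contradiction (trans (dec-false (x ≟ c) (<⇒≢ x<u)) (sym (dec-false (y ≟ c) (<⇒≢ y<u)))) sep

separator-below : ∀ t {x y u} → accepts t x ≢ accepts t y → u < x → u < y → accepts t u ≡ acceptsLow t
separator-below (lessThan c) {x} {y} {u} sep u<x u<y with u <ᵇ c | <ᵇ-reflects-< u c
... | true  | ofʸ _   = refl
... | false | ofⁿ u≮c =
  contradiction (trans (dec-false (x <? c) (λ x<c → u≮c (<-trans u<x x<c)))
                       (sym (dec-false (y <? c) (λ y<c → u≮c (<-trans u<y y<c))))) sep
separator-below (equalTo c) {x} {y} {u} sep u<x u<y with u ≡ᵇ c | ≡ᵇ-reflects-≡ u c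
... | false | ofⁿ _    = refl
... | true  | ofʸ refl =
  contradiction (trans (dec-false (x ≟ c) (<⇒≢ u<x ∘ sym)) (sym (dec-false (y ≟ c) (<⇒≢ u<y ∘ sym)))) sep

-- The geometric heart of the argument: if t answers alike on x and y,
-- and s separates x from y, then s answers alike on all positions at
-- which t answers differently from x.
one-side : ∀ t s {x y u v} →
  accepts t u ≢ accepts t x → accepts t v ≢ accepts t x → accepts t x ≡ accepts t y →
  accepts s x ≢ accepts s y → accepts s u ≡ accepts s v
one-side (lessThan c) s {x} {y} {u} {v} u≠x v≠x x=y sep
  with x <ᵇ c | <ᵇ-reflects-< x c | y <ᵇ c | <ᵇ-reflects-< y c
     | u <ᵇ c | <ᵇ-reflects-< u c | v <ᵇ c | <ᵇ-reflects-< v c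
... | true | ofʸ x<c | true | ofʸ y<c | false | ofⁿ u≮c | false | ofⁿ v≮c =
  trans (separator-above s sep (<-≤-trans x<c (≮⇒≥ u≮c)) (<-≤-trans y<c (≮⇒≥ u≮c)))
        (sym (separator-above s sep (<-≤-trans x<c (≮⇒≥ v≮c)) (<-≤-trans y<c (≮⇒≥ v≮c))))
... | false | ofⁿ x≮c | false | ofⁿ y≮c | true | ofʸ u<c | true | ofʸ v<c =
  trans (separator-below s sep (<-≤-trans u<c (≮⇒≥ x≮c)) (<-≤-trans u<c (≮⇒≥ y≮c)))
        (sym (separator-below s sep (<-≤-trans v<c (≮⇒≥ x≮c)) (<-≤-trans v<c (≮⇒≥ y≮c))))
... | true  | _ | false | _ | _     | _ | _     | _ = contradiction x=y λ ()
... | false | _ | true  | _ | _     | _ | _     | _ = contradiction x=y λ ()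
... | true  | _ | true  | _ | true  | _ | _     | _ = contradiction refl u≠x
... | true  | _ | true  | _ | _     | _ | true  | _ = contradiction refl v≠x
... | false | _ | false | _ | false | _ | _     | _ = contradiction refl u≠x
... | false | _ | false | _ | _     | _ | false | _ = contradiction refl v≠x
one-side (equalTo c) s {x} {y} {u} {v} u≠x v≠x x=y sep
  with x ≡ᵇ c | ≡ᵇ-reflects-≡ x c | y ≡ᵇ c | ≡ᵇ-reflects-≡ y c
     | u ≡ᵇ c | ≡ᵇ-reflects-≡ u c | v ≡ᵇ c | ≡ᵇ-reflects-≡ v c
... | true  | ofʸ refl | true  | ofʸ refl | _     | _        | _     | _        = contradiction refl sep
... | false | _        | false | _        | true  | ofʸ refl | true  | ofʸ refl = refl
... | true  | _        | false | _        | _     | _        | _     | _        = contradiction x=y λ ()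
... | false | _        | true  | _        | _     | _        | _     | _        = contradiction x=y λ ()
... | false | _        | false | _        | false | _        | _     | _        = contradiction refl u≠x
... | false | _        | false | _        | _     | _        | false | _        = contradiction refl v≠x

exits-one-side : ∀ {n} o (j : Fin n) so (sj : Fin n) {x y u v : Region n} →
  holds o j u ≢ holds o j x → holds o j v ≢ holds o j x → holds o j x ≡ holds o j y →
  holds so sj x ≢ holds so sj y → holds so sj u ≡ holds so sj v
exits-one-side o j so sj {x} {y} {u} {v}
  rewrite holds-accepts o j x | holds-accepts o j y | holds-accepts o j u | holds-accepts o j v
        | holds-accepts so sj x | holds-accepts so sj y | holds-accepts so sj u | holds-accepts so sj v
  = one-side (testAt o (toℕ j)) (testAt so (toℕ sj))

twice-injective : ∀ i k → twice i ≡ twice k → i ≡ k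
twice-injective zero    zero    _ = refl
twice-injective (suc i) (suc k) e = cong suc (twice-injective i k (suc-injective (suc-injective e)))

twice≢odd : ∀ i k → twice i ≢ suc (twice k)
twice≢odd (suc zero)    zero    ()
twice≢odd (suc (suc i)) zero    ()
twice≢odd (suc i)       (suc k) e = twice≢odd i k (suc-injective (suc-injective e))

pos-injective : ∀ {n} {r s : Region n} → pos r ≡ pos s → r ≡ s
pos-injective {r = gap i} {gap i′} e = cong gap (toℕ-injective (twice-injective _ _ e))
pos-injective {r = gap i} {key k}  e = contradiction e (twice≢odd _ _)
pos-injective {r = key k} {gap i}  e = contradiction (sym e) (twice≢odd _ _)
pos-injective {r = key k} {key k′} e = cong key (toℕ-injective (twice-injective _ _ (suc-injective e)))

key-injective : ∀ {n} {i k : Fin n} → key i ≡ key k → i ≡ k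
key-injective refl = refl

eq-test-self : ∀ {n} (a : Fin n) → holds op= a (key a) ≡ true
eq-test-self a = trans (holds-accepts op= a (key a)) (dec-true (pos (key a) ≟ pos (key a)) refl)

eq-test-key : ∀ {n} {a : Fin n} {r} → holds op= a r ≡ true → r ≡ key a
eq-test-key {a = a} {r} h with pos r ≡ᵇ pos (key a) | ≡ᵇ-reflects-≡ (pos r) (pos (key a)) | holds-accepts op= a r
... | true  | ofʸ same | _  = pos-injective same
... | false | _        | eq = contradiction (trans (sym h) eq) λ ()

eq-test-other : ∀ {n} {a : Fin n} {r} → r ≢ key a → holds op= a r ≡ false
eq-test-other {a = a} {r} r≠a with holds op= a r in h
... | true  = contradiction (eq-test-key h) r≠a
... | false = refl

branch : ∀ {n} → Bool → Tree n → Tree n → Tree n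
branch true  y m = y
branch false y m = m

reach : ∀ {n} → Tree n → Region n → List Bool
reach leaf           r = []
reach (node o j y m) r with holds o j r
... | true  = true ∷ reach y r
... | false = false ∷ reach m r

child-depth : ∀ {n} o (j : Fin n) y m {r b} → holds o j r ≡ b →
  depth (node o j y m) r ≡ suc (depth (branch b y m) r)
child-depth o j y m {r} refl with holds o j r
... | true  = refl
... | false = refl

child-reach : ∀ {n} o (j : Fin n) y m {r b} → holds o j r ≡ b →
  reach (node o j y m) r ≡ b ∷ reach (branch b y m) r
child-reach o j y m {r} refl with holds o j r
... | true  = refl
... | false = refl

depth-node-pos : ∀ {n} o (j : Fin n) y m r → 1 ≤ depth (node o j y m) r
depth-node-pos o j y m r rewrite child-depth o j y m {r} refl = s≤s z≤n

sideNode : ∀ {n} → Op → Fin n → Bool → Tree n → Tree n → Tree n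
sideNode o j s X Y = node o j (branch s X Y) (branch s Y X)

branch-same : ∀ {n} s (X Y : Tree n) → branch s (branch s X Y) (branch s Y X) ≡ X
branch-same true  X Y = refl
branch-same false X Y = refl

branch-other : ∀ {n} s (X Y : Tree n) → branch (not s) (branch s X Y) (branch s Y X) ≡ Y
branch-other true  X Y = refl
branch-other false X Y = refl

-- Regions answering s at a sideNode continue in X (lemmas marked ˢ), all
-- others in Y (lemmas marked ᵒ).
module Side {n : ℕ} (o : Op) (j : Fin n) (s : Bool) (X Y : Tree n) where

  side-depthˢ : ∀ {r} → holds o j r ≡ s → depth (sideNode o j s X Y) r ≡ suc (depth X r)
  side-depthˢ h = trans (child-depth o j _ _ h) (cong (λ t → suc (depth t _)) (branch-same s X Y))

  side-reachˢ : ∀ {r} → holds o j r ≡ s → reach (sideNode o j s X Y) r ≡ s ∷ reach X r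
  side-reachˢ h = trans (child-reach o j _ _ h) (cong (λ t → s ∷ reach t _) (branch-same s X Y))

  side-depthᵒ : ∀ {r} → holds o j r ≢ s → depth (sideNode o j s X Y) r ≡ suc (depth Y r)
  side-depthᵒ h = trans (child-depth o j _ _ (¬-not h)) (cong (λ t → suc (depth t _)) (branch-other s X Y))

  side-reachᵒ : ∀ {r} → holds o j r ≢ s → reach (sideNode o j s X Y) r ≡ not s ∷ reach Y r
  side-reachᵒ h = trans (child-reach o j _ _ (¬-not h)) (cong (λ t → not s ∷ reach t _) (branch-other s X Y))

module _ {n : ℕ} where

  passes? : ∀ (T : Tree n) r p → Dec (Passes T r p)
  passes? T              r []          = accept here
  passes? leaf           r (b ∷ p)     = reject λ ()
  passes? (node o j y m) r (true ∷ p)  =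
    map′ (λ (h , q) → yes h q) (λ { (yes h q) → h , q }) ((holds o j r ≟ᵇ true) ×-dec passes? y r p)
  passes? (node o j y m) r (false ∷ p) =
    map′ (λ (h , q) → no h q) (λ { (no h q) → h , q }) ((holds o j r ≟ᵇ false) ×-dec passes? m r p)

  passes-prefix : ∀ {T : Tree n} {r} P {X} → Passes T r (P ++ X) → Passes T r P
  passes-prefix []      _         = here
  passes-prefix (_ ∷ P) (yes h q) = yes h (passes-prefix P q)
  passes-prefix (_ ∷ P) (no h q)  = no h (passes-prefix P q)

  passes-after : ∀ {T : Tree n} {r P X S} → Passes T r (P ++ X) → T at P ≡ S → Passes S r X
  passes-after q         here    = q
  passes-after (yes h q) (yes a) = passes-after q a
  passes-after (no h q)  (no a)  = passes-after q a

  passes-extend : ∀ {T : Tree n} {r P X S} → Passes T r P → T at P ≡ S → Passes S r X → Passes T r (P ++ X)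
  passes-extend here      here    q = q
  passes-extend (yes h p) (yes a) q = yes h (passes-extend p a q)
  passes-extend (no h p)  (no a)  q = no h (passes-extend p a q)

  at-extend : ∀ {T : Tree n} {P X S U} → T at P ≡ S → S at X ≡ U → T at (P ++ X) ≡ U
  at-extend here    b = b
  at-extend (yes a) b = yes (at-extend a b)
  at-extend (no a)  b = no (at-extend a b)

  at-suffix : ∀ {T : Tree n} {P X S U} → T at P ≡ S → T at (P ++ X) ≡ U → S at X ≡ U
  at-suffix here    b       = b
  at-suffix (yes a) (yes b) = at-suffix a b
  at-suffix (no a)  (no b)  = at-suffix a b

  passes-no : ∀ {o j} {y m S : Tree n} {r b q} → holds o j r ≡ false →
    Passes (node o j y m) r (b ∷ q) → node o j y m at (b ∷ q) ≡ S → Passes m r q × m at q ≡ S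
  passes-no h (yes h′ _) _      = contradiction (trans (sym h′) h) λ ()
  passes-no h (no _ pq)  (no a) = pq , a

  reach-passes : ∀ (T : Tree n) r → Passes T r (reach T r)
  reach-passes leaf           r = here
  reach-passes (node o j y m) r with holds o j r in h
  ... | true  = yes h (reach-passes y r)
  ... | false = no h (reach-passes m r)

  reach-leaf : ∀ (T : Tree n) r → T at (reach T r) ≡ leaf
  reach-leaf leaf           r = here
  reach-leaf (node o j y m) r with holds o j r
  ... | true  = yes (reach-leaf y r)
  ... | false = no (reach-leaf m r)

  reach-at : ∀ {T : Tree n} {P S r} → T at P ≡ S → Passes T r P → reach T r ≡ P ++ reach S r
  reach-at here    _         = refl
  reach-at {node o j y m} (yes a) (yes h q) = trans (child-reach o j y m h) (cong (true ∷_) (reach-at a q))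
  reach-at {node o j y m} (no a)  (no h q)  = trans (child-reach o j y m h) (cong (false ∷_) (reach-at a q))

  passes-leaf : ∀ {T : Tree n} {P r} → Passes T r P → T at P ≡ leaf → reach T r ≡ P
  passes-leaf {P = P} q a = trans (reach-at a q) (++-identityʳ P)

  SameLeafSameRelation : (Region n → Set) → Tree n → Set
  SameLeafSameRelation Q T = ∀ r s → Q r → Q s → reach T r ≡ reach T s → ∀ j → relation r j ≡ relation s j

  correct⇒sameLeaf : ∀ {Q : Region n → Set} {T : Tree n} → Correct Q T → SameLeafSameRelation Q T
  correct⇒sameLeaf {T = T} c r s qr qs e =
    c (reach T r) r s (reach-leaf T r) (qr , reach-passes T r) (qs , subst (Passes T s) (sym e) (reach-passes T s))

  sameLeaf⇒correct : ∀ {Q : Region n → Set} {T : Tree n} → SameLeafSameRelation Q T → Correct Q T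
  sameLeaf⇒correct c p r s al (qr , pr) (qs , ps) =
    c r s qr qs (trans (passes-leaf pr al) (sym (passes-leaf ps al)))

  -- In an irreducible tree the key K_z reaches every node "v = K_z":
  -- otherwise that node and its no-child would receive the same queries.
  irreducible-eq-visited : ∀ {Q T z Y N} P → Irreducible Q T → T at P ≡ node op= z Y N → Passes T (key z) P
  irreducible-eq-visited {Q} {T} {z} {Y} {N} P irr atP with passes? T (key z) P
  ... | accept pz = pz
  ... | reject npz = ⊥-elim (irr P false N (at-extend atP (no here)) (λ r → up r , down r))
    where
    up : ∀ r → QAt Q T (P ++ false ∷ []) r → QAt Q T P r
    up r (qr , pr) = qr , passes-prefix P pr
    fails : ∀ r → Passes T r P → holds op= z r ≡ false
    fails r pr = eq-test-other (λ r≡z → npz (subst (λ x → Passes T x P) r≡z pr))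
    down : ∀ r → QAt Q T P r → QAt Q T (P ++ false ∷ []) r
    down r (qr , pr) = qr , passes-extend pr atP (no (fails r pr) here)

module _ {n : ℕ} where

  replace : Tree n → List Bool → Tree n → Tree n
  replace T              []          X = X
  replace leaf           (_ ∷ P)     X = leaf
  replace (node o j y m) (true ∷ P)  X = node o j (replace y P X) m
  replace (node o j y m) (false ∷ P) X = node o j y (replace m P X)

  reach-replace : ∀ {T P S} X → T at P ≡ S → ∀ r s →
    reach (replace T P X) r ≡ reach (replace T P X) s →
    reach T r ≡ reach T s ⊎ (Passes T r P × Passes T s P × reach X r ≡ reach X s)
  reach-replace X here r s e = inj₂ (here , here , e)
  reach-replace {node o j y m} X (yes a) r s e with holds o j r in er | holds o j s in es
  ... | true | true with reach-replace X a r s (∷-injectiveʳ e)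
  ...   | inj₁ e′               = inj₁ (cong (true ∷_) e′)
  ...   | inj₂ (pr , ps , e′)   = inj₂ (yes er pr , yes es ps , e′)
  reach-replace X (yes a) r s () | true  | false
  reach-replace X (yes a) r s () | false | true
  reach-replace X (yes a) r s e  | false | false = inj₁ e
  reach-replace {node o j y m} X (no a) r s e with holds o j r in er | holds o j s in es
  ... | false | false with reach-replace X a r s (∷-injectiveʳ e)
  ...   | inj₁ e′               = inj₁ (cong (false ∷_) e′)
  ...   | inj₂ (pr , ps , e′)   = inj₂ (no er pr , no es ps , e′)
  reach-replace X (no a) r s () | true  | false
  reach-replace X (no a) r s () | false | true
  reach-replace X (no a) r s e  | true  | true  = inj₁ e

  depth-replace : ∀ {T P S} X → T at P ≡ S → ∀ r (u v : ℕ) →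
    (Passes T r P → depth X r + u ≤ depth S r + v) → (¬ Passes T r P → u ≤ v) →
    depth (replace T P X) r + u ≤ depth T r + v
  depth-replace X here r u v inside outside = inside here
  depth-replace {node o j y m} X (yes a) r u v inside outside with holds o j r in e
  ... | true  = s≤s (depth-replace X a r u v (inside ∘ yes e) (λ np → outside λ { (yes _ q) → np q }))
  ... | false = s≤s (+-mono-≤ ≤-refl (outside λ { (yes h _) → contradiction (trans (sym h) e) λ () }))
  depth-replace {node o j y m} X (no a) r u v inside outside with holds o j r in e
  ... | false = s≤s (depth-replace X a r u v (inside ∘ no e) (λ np → outside λ { (no _ q) → np q }))
  ... | true  = s≤s (+-mono-≤ ≤-refl (outside λ { (no h _) → contradiction (trans (sym e) h) λ () }))

  uses-branch : ∀ {C y m} b → UsesOnly {n} C y → UsesOnly C m → UsesOnly C (branch b y m)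
  uses-branch true  uy um = uy
  uses-branch false uy um = um

  uses-root : ∀ {C o j} {y m : Tree n} → UsesOnly C (node o j y m) → C o
  uses-root (node c _ _) = c

  uses-no : ∀ {C o j} {y m : Tree n} → UsesOnly C (node o j y m) → UsesOnly C m
  uses-no (node _ _ um) = um

  uses-at : ∀ {C} {T : Tree n} {P S} → UsesOnly C T → T at P ≡ S → UsesOnly C S
  uses-at u              here    = u
  uses-at (node c uy um) (yes a) = uses-at uy a
  uses-at (node c uy um) (no a)  = uses-at um a

  uses-replace : ∀ {C T X} P → UsesOnly {n} C T → UsesOnly C X → UsesOnly C (replace T P X)
  uses-replace []          u              ux = ux
  uses-replace (_ ∷ P)     leaf           ux = leaf
  uses-replace (true ∷ P)  (node c uy um) ux = node c (uses-replace P uy ux) um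
  uses-replace (false ∷ P) (node c uy um) ux = node c uy (uses-replace P um ux)

-- Sums of weights in an ordered commutative ring (F need not be a field,
-- so natural multiples k · x stand in for products with counts).

module OrderedAlgebra {c ℓ₁ ℓ₂} (F : OrderedCommRing c ℓ₁ ℓ₂) where
  open OrderedCommRing F
    using (Carrier; _≈_; 0#; -_; +-comm; +-assoc; +-cong; +-identityˡ; +-identityʳ; -‿inverseʳ;
           isTotalOrder; +-commutativeSemigroup)
    renaming (_+_ to _⊕_; _≤_ to _≤ᶠ_; +-mono-≤ to ⊕-monoˡ; refl to ≈-refl; sym to ≈-sym; trans to ≈-trans)
  open IsTotalOrder isTotalOrder
    using (total; ≲-respˡ-≈; ≲-respʳ-≈) renaming (refl to ≤ᶠ-refl; trans to ≤ᶠ-trans)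
  open WithWeights F
  open import Algebra.Properties.CommutativeSemigroup +-commutativeSemigroup using (interchange)

  ⊕-monoʳ : ∀ {x y} z → x ≤ᶠ y → (z ⊕ x) ≤ᶠ (z ⊕ y)
  ⊕-monoʳ {x} {y} z h = ≲-respʳ-≈ (+-comm y z) (≲-respˡ-≈ (+-comm x z) (⊕-monoˡ z h))

  ⊕-mono : ∀ {x y u v} → x ≤ᶠ y → u ≤ᶠ v → (x ⊕ u) ≤ᶠ (y ⊕ v)
  ⊕-mono {y = y} {u} h₁ h₂ = ≤ᶠ-trans (⊕-monoˡ u h₁) (⊕-monoʳ y h₂)

  ⊕-cancelʳ : ∀ {x y c} → (x ⊕ c) ≤ᶠ (y ⊕ c) → x ≤ᶠ y
  ⊕-cancelʳ {x} {y} {c} h = ≲-respʳ-≈ (undo y) (≲-respˡ-≈ (undo x) (⊕-monoˡ (- c) h))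
    where
    undo : ∀ u → (u ⊕ c) ⊕ - c ≈ u
    undo u = ≈-trans (+-assoc u c (- c)) (≈-trans (+-cong ≈-refl (-‿inverseʳ c)) (+-identityʳ u))

  ⊕-cancelˡ : ∀ {x y c} → (c ⊕ x) ≤ᶠ (c ⊕ y) → x ≤ᶠ y
  ⊕-cancelˡ {x} {y} {c} h = ⊕-cancelʳ (≲-respʳ-≈ (+-comm c y) (≲-respˡ-≈ (+-comm c x) h))

  ·-nonneg : ∀ {x} → 0# ≤ᶠ x → ∀ k → 0# ≤ᶠ (k · x)
  ·-nonneg h zero    = ≤ᶠ-refl
  ·-nonneg h (suc k) = ≲-respˡ-≈ (+-identityˡ 0#) (⊕-mono h (·-nonneg h k))

  ·-distribʳ : ∀ m k x → ((m + k) · x) ≈ (m · x) ⊕ (k · x)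
  ·-distribʳ zero    k x = ≈-sym (+-identityˡ (k · x))
  ·-distribʳ (suc m) k x = ≈-trans (+-cong ≈-refl (·-distribʳ m k x)) (≈-sym (+-assoc x (m · x) (k · x)))

  ·-monoˡ : ∀ {m k x} → m ≤ k → 0# ≤ᶠ x → (m · x) ≤ᶠ (k · x)
  ·-monoˡ {k = k} z≤n     h = ·-nonneg h k
  ·-monoˡ {x = x} (s≤s p) h = ⊕-monoʳ x (·-monoˡ p h)

  ·-monoʳ : ∀ {x y} k → x ≤ᶠ y → (k · x) ≤ᶠ (k · y)
  ·-monoʳ zero    h = ≤ᶠ-refl
  ·-monoʳ (suc k) h = ⊕-mono h (·-monoʳ k h)

  -- In a total order a positive multiple can be cancelled.
  ·-cancel : ∀ k {x y} → 1 ≤ k → (k · x) ≤ᶠ (k · y) → x ≤ᶠ y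
  ·-cancel (suc k) {x} {y} _ h with total x y
  ... | inj₁ x≤y = x≤y
  ... | inj₂ y≤x = ⊕-cancelʳ (≤ᶠ-trans (⊕-monoʳ x (·-monoʳ k y≤x)) h)

  Σ-mono : ∀ {A : Set} {f g : A → Carrier} → (∀ x → f x ≤ᶠ g x) → ∀ xs → Σ xs f ≤ᶠ Σ xs g
  Σ-mono h []       = ≤ᶠ-refl
  Σ-mono h (x ∷ xs) = ⊕-mono (h x) (Σ-mono h xs)

  Σ-cong : ∀ {A : Set} {f g : A → Carrier} → (∀ x → f x ≈ g x) → ∀ xs → Σ xs f ≈ Σ xs g
  Σ-cong h []       = ≈-refl
  Σ-cong h (x ∷ xs) = +-cong (h x) (Σ-cong h xs)

  Σ-⊕ : ∀ {A : Set} (f g : A → Carrier) xs → Σ xs (λ x → f x ⊕ g x) ≈ Σ xs f ⊕ Σ xs g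
  Σ-⊕ f g []       = ≈-sym (+-identityˡ 0#)
  Σ-⊕ f g (x ∷ xs) = ≈-trans (+-cong ≈-refl (Σ-⊕ f g xs)) (interchange (f x) (g x) (Σ xs f) (Σ xs g))

  Σ-++ : ∀ {A : Set} (f : A → Carrier) xs ys → Σ (xs ++ ys) f ≈ Σ xs f ⊕ Σ ys f
  Σ-++ f []       ys = ≈-sym (+-identityˡ _)
  Σ-++ f (x ∷ xs) ys = ≈-trans (+-cong ≈-refl (Σ-++ f xs ys)) (≈-sym (+-assoc (f x) _ _))

  Σ-map : ∀ {A B : Set} (h : A → B) (f : B → Carrier) xs → Σ (map h xs) f ≈ Σ xs (f ∘ h)
  Σ-map h f []       = ≈-refl
  Σ-map h f (x ∷ xs) = +-cong ≈-refl (Σ-map h f xs)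

  Σ-multiplicities : ∀ {A : Set} (k l : A → ℕ) (w : A → Carrier) xs →
    Σ xs (λ r → (k r + l r) · w r) ≈ Σ xs (λ r → k r · w r) ⊕ Σ xs (λ r → l r · w r)
  Σ-multiplicities k l w xs =
    ≈-trans (Σ-cong (λ r → ·-distribʳ (k r) (l r) (w r)) xs) (Σ-⊕ (λ r → k r · w r) (λ r → l r · w r) xs)

  Σ-tabulate-zero : ∀ {A : Set} {m} (g : Fin m → A) (f : A → Carrier) →
    (∀ i → f (g i) ≈ 0#) → Σ (tabulate g) f ≈ 0#
  Σ-tabulate-zero {m = zero}  g f z = ≈-refl
  Σ-tabulate-zero {m = suc m} g f z =
    ≈-trans (+-cong (z Fin.zero) (Σ-tabulate-zero (g ∘ Fin.suc) f (z ∘ Fin.suc))) (+-identityˡ 0#)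

  Σ-tabulate-single : ∀ {A : Set} {m} (g : Fin m → A) (f : A → Carrier) (a : Fin m) →
    (∀ i → i ≢ a → f (g i) ≈ 0#) → Σ (tabulate g) f ≈ f (g a)
  Σ-tabulate-single {m = suc m} g f Fin.zero z =
    ≈-trans (+-cong ≈-refl (Σ-tabulate-zero (g ∘ Fin.suc) f (λ i → z (Fin.suc i) λ ())))
            (+-identityʳ _)
  Σ-tabulate-single {m = suc m} g f (Fin.suc a) z =
    ≈-trans (+-cong (z Fin.zero λ ()) (Σ-tabulate-single (g ∘ Fin.suc) f a (λ i i≢a → z (Fin.suc i) (i≢a ∘ Fin-suc-injective))))
            (+-identityˡ _)

  Σ-regions-single : ∀ {n} (f : Region n → Carrier) (a : Fin n) →
    (∀ r → r ≢ key a → f r ≈ 0#) → Σ (allRegions n) f ≈ f (key a)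
  Σ-regions-single {n} f a z =
    ≈-trans (Σ-++ f (map gap (allFin (suc n))) (map key (allFin n)))
    (≈-trans (+-cong gaps keys) (+-identityˡ _))
    where
    gaps : Σ (map gap (allFin (suc n))) f ≈ 0#
    gaps = ≈-trans (Σ-map gap f (allFin (suc n))) (Σ-tabulate-zero id (f ∘ gap) (λ i → z (gap i) λ ()))
    keys : Σ (map key (allFin n)) f ≈ f (key a)
    keys = ≈-trans (Σ-map key f (allFin n))
                   (Σ-tabulate-single id (f ∘ key) a (λ i i≢a → z (key i) (i≢a ∘ key-injective)))

every-region : ∀ {n} (r : Region n) → r ∈ allRegions n
every-region {n} (gap i) = ∈-++⁺ˡ (∈-map⁺ gap (∈-allFin i))
every-region {n} (key k) = ∈-++⁺ʳ (map gap (allFin (suc n))) (∈-map⁺ key (∈-allFin k))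

-- The cut of a subtree U along the walk of K_z towards the node "v = K_z".

module Cutting {n : ℕ} (C : Op → Set) (eqAllowed : C op=) (a z : Fin n)
               (z-not-a : holds op= z (key a) ≡ false) where

  A Z : Region n
  A = key a
  Z = key z

  record Cut : Set where
    constructor cutAt
    field
      sepOp  : Op
      sepKey : Fin n
      onA    : Tree n
      onZ    : Tree n
  open Cut public

  sep : Cut → Region n → Bool
  sep c = holds (sepOp c) (sepKey c)

  SideA SideZ : Cut → Region n → Set
  SideA c r = sep c r ≡ sep c A
  SideZ c r = sep c r ≢ sep c A

  record Good (U : Tree n) (c : Cut) : Set where
    field
      separates : sep c A ≢ sep c Z
      budget    : depth (onA c) A + depth (onZ c) Z ≤ depth U Z
      a-tested  : 1 ≤ depth (onA c) A
      depthA    : ∀ r → holds op= a r ≡ false → SideA c r → depth (onA c) r ≤ depth U r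
      depthZ    : ∀ r → SideZ c r → depth (onZ c) r ≤ depth U r
      faithfulA : ∀ r s → holds op= a r ≡ false → holds op= a s ≡ false → SideA c r → SideA c s →
                  reach (onA c) r ≡ reach (onA c) s → reach U r ≡ reach U s
      faithfulZ : ∀ r s → SideZ c r → SideZ c s → reach (onZ c) r ≡ reach (onZ c) s → reach U r ≡ reach U s
      isolatesA : ∀ r → SideA c r → reach (onA c) r ≡ reach (onA c) A → holds op= a r ≡ true
      allowed   : UsesOnly C U → UsesOnly C (onA c) × UsesOnly C (onZ c) × C (sepOp c)

  base : Op → Fin n → Tree n → Tree n → Cut
  base o j y m = cutAt o j (node op= a leaf (branch (holds o j A) y m)) (branch (not (holds o j A)) y m)

  base-good : ∀ o j y m → holds o j A ≢ holds o j Z → Good (node o j y m) (base o j y m)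
  base-good o j y m separating = record
    { separates = separating
    ; budget    = ≤-reflexive (trans (cong (_+ depth E Z) (child-depth op= a leaf X (eq-test-self a)))
                                     (sym (child-depth o j y m (¬-not (separating ∘ sym)))))
    ; a-tested  = depth-node-pos op= a leaf X A
    ; depthA    = λ r ha hr → ≤-reflexive (trans (child-depth op= a leaf X ha) (sym (child-depth o j y m hr)))
    ; depthZ    = λ r hr → ≤-trans (n≤1+n _) (≤-reflexive (sym (child-depth o j y m (¬-not hr))))
    ; faithfulA = λ r s ha hs hr hs′ e →
        trans (child-reach o j y m hr)
          (trans (cong (sA ∷_) (∷-injectiveʳ (trans (sym (child-reach op= a leaf X ha)) (trans e (child-reach op= a leaf X hs)))))
                 (sym (child-reach o j y m hs′)))
    ; faithfulZ = λ r s hr hs e →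
        trans (child-reach o j y m (¬-not hr)) (trans (cong (not sA ∷_) e) (sym (child-reach o j y m (¬-not hs))))
    ; isolatesA = λ r hr e →
        ∷-injectiveˡ (trans (sym (child-reach op= a leaf X refl)) (trans e (child-reach op= a leaf X (eq-test-self a))))
    ; allowed   = λ { (node c uy um) → node eqAllowed leaf (uses-branch sA uy um) , uses-branch (not sA) uy um , c }
    }
    where
    sA = holds o j A
    X  = branch sA y m
    E  = branch (not sA) y m

  module Keep (o : Op) (j : Fin n) (y m : Tree n) (d : Bool)
              (P : Region n → Set) (P? : Decidable P) (X : Tree n) where

    U E : Tree n
    U = node o j y m
    E = branch (not d) y m

    Exit : Region n → Set
    Exit r = holds o j r ≢ d × P r

    -- Kept opaque so that the trees below are built from an unevaluated decision.
    opaque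
      exits? : Dec (Any Exit (allRegions n))
      exits? = any? (λ r → ¬? (holds o j r ≟ᵇ d) ×-dec P? r) (allRegions n)

    K : Tree n
    K = if does exits? then sideNode o j d X E else X

    extra : ℕ
    extra = if does exits? then 1 else 0

    stays : ¬ Any Exit (allRegions n) → ∀ {r} → P r → holds o j r ≡ d
    stays none {r} pr with holds o j r ≟ᵇ d
    ... | accept h = h
    ... | reject h = contradiction (lose (every-region r) (h , pr)) none

    K-depth-stay : ∀ {r} → holds o j r ≡ d → depth K r ≡ extra + depth X r
    K-depth-stay h with exits?
    ... | accept _ = Side.side-depthˢ o j d X E h
    ... | reject _ = refl

    K-depth : ∀ {r} → P r → (holds o j r ≡ d → depth X r ≤ depth (branch d y m) r) → depth K r ≤ depth U r
    K-depth {r} pr inner with holds o j r ≟ᵇ d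
    ... | accept h = ≤-trans (≤-reflexive (K-depth-stay h))
                       (≤-trans (+-mono-≤ extra≤1 (inner h)) (≤-reflexive (sym (child-depth o j y m h))))
      where
      extra≤1 : extra ≤ 1
      extra≤1 with does exits?
      ... | true  = ≤-refl
      ... | false = z≤n
    ... | reject h with exits?
    ...   | accept _    = ≤-reflexive (trans (Side.side-depthᵒ o j d X E h) (sym (child-depth o j y m (¬-not h))))
    ...   | reject none = contradiction (stays none pr) h

    K-leaf : ∀ {r s} → P r → P s → reach K r ≡ reach K s →
      (holds o j r ≡ d × holds o j s ≡ d × reach X r ≡ reach X s) ⊎
      (holds o j r ≢ d × holds o j s ≢ d × reach U r ≡ reach U s)
    K-leaf {r} {s} pr ps e with exits?
    ... | reject none = inj₁ (stays none pr , stays none ps , e)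
    ... | accept _ with holds o j r ≟ᵇ d | holds o j s ≟ᵇ d
    ...   | accept hr | accept hs =
            inj₁ (hr , hs , ∷-injectiveʳ (trans (sym (Side.side-reachˢ o j d X E hr)) (trans e (Side.side-reachˢ o j d X E hs))))
    ...   | reject hr | reject hs =
            inj₂ (hr , hs , trans (child-reach o j y m (¬-not hr))
                              (trans (sym (Side.side-reachᵒ o j d X E hr))
                              (trans e (trans (Side.side-reachᵒ o j d X E hs) (sym (child-reach o j y m (¬-not hs)))))))
    ...   | accept hr | reject hs =
            contradiction (∷-injectiveˡ (trans (sym (Side.side-reachˢ o j d X E hr)) (trans e (Side.side-reachᵒ o j d X E hs)))) (not-¬ refl)
    ...   | reject hr | accept hs =
            contradiction (∷-injectiveˡ (trans (sym (Side.side-reachˢ o j d X E hs)) (trans (sym e) (Side.side-reachᵒ o j d X E hr)))) (not-¬ refl)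

    K-faithful : ∀ {r s} → P r → P s →
      (holds o j r ≡ d → holds o j s ≡ d → reach X r ≡ reach X s → reach (branch d y m) r ≡ reach (branch d y m) s) →
      reach K r ≡ reach K s → reach U r ≡ reach U s
    K-faithful pr ps inner e with K-leaf pr ps e
    ... | inj₁ (hr , hs , eX) = trans (child-reach o j y m hr) (trans (cong (d ∷_) (inner hr hs eX)) (sym (child-reach o j y m hs)))
    ... | inj₂ (_ , _ , eU)   = eU

    K-pos : ∀ {r} → 1 ≤ depth X r → 1 ≤ depth K r
    K-pos {r} h with does exits?
    ... | true  = depth-node-pos o j (branch d X E) (branch d E X) r
    ... | false = h

    K-allowed : C o → UsesOnly C y → UsesOnly C m → UsesOnly C X → UsesOnly C K
    K-allowed co uy um ux with does exits?
    ... | true  = node co (uses-branch d ux (uses-branch (not d) uy um)) (uses-branch d (uses-branch (not d) uy um) ux)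
    ... | false = ux

  module Extend (o : Op) (j : Fin n) (y m : Tree n) (d : Bool) (c : Cut) (IH : Good (branch d y m) c)
                (Z-stays : holds o j Z ≡ d) (agree : holds o j A ≡ holds o j Z) where
    private module IH = Good IH

    A-stays : holds o j A ≡ d
    A-stays = trans agree Z-stays

    module KA = Keep o j y m d (SideA c) (λ r → sep c r ≟ᵇ sep c A) (onA c)
    module KZ = Keep o j y m d (SideZ c) (λ r → ¬? (sep c r ≟ᵇ sep c A)) (onZ c)

    extended : Cut
    extended = cutAt (sepOp c) (sepKey c) KA.K KZ.K

    -- No comparison of the walk is kept on both sides: the regions leaving
    -- the walk at (o,j) all lie on one side of the separator.
    kept-once : KA.extra + KZ.extra ≤ 1
    kept-once with KA.exits? | KZ.exits?
    ... | accept exA | accept exZ =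
          let (r₁ , r₁-exits , r₁-onA) = satisfied exA
              (r₂ , r₂-exits , r₂-onZ) = satisfied exZ
              same = exits-one-side o j (sepOp c) (sepKey c)
                       (r₁-exits ∘ (λ e → trans e A-stays)) (r₂-exits ∘ (λ e → trans e A-stays)) agree IH.separates
          in contradiction (trans (sym same) r₁-onA) r₂-onZ
    ... | accept _ | reject _ = ≤-refl
    ... | reject _ | accept _ = ≤-refl
    ... | reject _ | reject _ = z≤n

    good : Good (node o j y m) extended
    good = record
      { separates = IH.separates
      ; budget    = ≤-trans (≤-reflexive (trans (cong₂ _+_ (KA.K-depth-stay A-stays) (KZ.K-depth-stay Z-stays))
                                                (+-interchange KA.extra _ KZ.extra _)))
                            (≤-trans (+-mono-≤ kept-once IH.budget) (≤-reflexive (sym (child-depth o j y m Z-stays))))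
      ; a-tested  = KA.K-pos IH.a-tested
      ; depthA    = λ r ha hr → KA.K-depth hr (λ _ → IH.depthA r ha hr)
      ; depthZ    = λ r hr → KZ.K-depth hr (λ _ → IH.depthZ r hr)
      ; faithfulA = λ r s ha hs hr hs′ → KA.K-faithful hr hs′ (λ _ _ → IH.faithfulA r s ha hs hr hs′)
      ; faithfulZ = λ r s hr hs → KZ.K-faithful hr hs (λ _ _ → IH.faithfulZ r s hr hs)
      ; isolatesA = isolatesA
      ; allowed   = allowed
      }
      where
      isolatesA : ∀ r → SideA c r → reach KA.K r ≡ reach KA.K A → holds op= a r ≡ true
      isolatesA r hr e with KA.K-leaf hr refl e
      ... | inj₁ (_ , _ , eX)       = IH.isolatesA r hr eX
      ... | inj₂ (_ , A-exits , _)  = contradiction A-stays A-exits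
      allowed : UsesOnly C (node o j y m) → UsesOnly C KA.K × UsesOnly C KZ.K × C (sepOp c)
      allowed (node co uy um) with IH.allowed (uses-branch d uy um)
      ... | uA , uZ , cs = KA.K-allowed co uy um uA , KZ.K-allowed co uy um uZ , cs

  cut : ∀ U q {Y N} → Passes U Z q → U at q ≡ node op= z Y N → ∃ (Good U)
  cut leaf q _ ()
  cut (node o j y m) q pz atZ with holds o j A ≟ᵇ holds o j Z
  ... | reject separating = base o j y m , base-good o j y m separating
  cut (node o j y m) []          here       here       | accept agree =
    contradiction (trans agree (eq-test-self z)) (λ e → contradiction (trans (sym z-not-a) e) λ ())
  cut (node o j y m) (true ∷ q)  (yes h pz) (yes atZ)  | accept agree =
    let (c , G) = cut y q pz atZ in Extend.extended o j y m true c G h agree , Extend.good o j y m true c G h agree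
  cut (node o j y m) (false ∷ q) (no h pz)  (no atZ)   | accept agree =
    let (c , G) = cut m q pz atZ in Extend.extended o j y m false c G h agree , Extend.good o j y m false c G h agree

-- Replace the subtree OLD = "v = K_a" by NEW, the separator
-- of the cut of Na with the two sides of the cut below it.  The result T′
-- is correct and  cost T′ + D·β_z ≤ cost T + D·β_a,  where D ≥ 1 is the
-- depth of K_a below the separator; optimality of T then yields β_z ≤ β_a.

module Exchange {ℓ ℓ₁ ℓ₂} (F : OrderedCommRing ℓ ℓ₁ ℓ₂) {n : ℕ} (C : Op → Set) (Q : Region n → Set)
                (w : Region n → OrderedCommRing.Carrier F) (dist : WithWeights.Distribution F Q w)
                (T : Tree n) (opt : WithWeights.Optimal F C Q w T)
                (p : List Bool) (a z : Fin n) (Ya Na : Tree n) (atA : T at p ≡ node op= a Ya Na)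
                (q : List Bool) (Yz Nz : Tree n) (atZ : Na at q ≡ node op= z Yz Nz)
                (z-in-Na : Passes Na (key z) q) (z-reaches-A : Passes T (key z) p)
                (z-not-a : holds op= z (key a) ≡ false) where
  open OrderedCommRing F using (_≈_; 0#; isTotalOrder)
    renaming (_+_ to _⊕_; _≤_ to _≤ᶠ_; +-mono-≤ to ⊕-monoˡ; refl to ≈-refl; trans to ≈-trans; reflexive to ≈-reflexive; +-cong to ⊕-cong)
  open IsTotalOrder isTotalOrder using (≲-respˡ-≈; ≲-respʳ-≈) renaming (trans to ≤ᶠ-trans)
  open WithWeights F
  open OrderedAlgebra F

  usesT : UsesOnly C T
  usesT = proj₁ opt

  correctT : Correct Q T
  correctT = proj₁ (proj₂ opt)

  eqAllowed : C op=
  eqAllowed = uses-root (uses-at usesT atA)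

  open Cutting C eqAllowed a z z-not-a

  c : Cut
  c = proj₁ (cut Na q z-in-Na atZ)

  private module G = Good (proj₂ (cut Na q z-in-Na atZ))

  s₀ : Bool
  s₀ = sep c A

  OLD NEW T′ : Tree n
  OLD = node op= a Ya Na
  NEW = sideNode (sepOp c) (sepKey c) s₀ (onA c) (onZ c)
  T′  = replace T p NEW

  D : ℕ
  D = depth (onA c) A

  module NEW = Side (sepOp c) (sepKey c) s₀ (onA c) (onZ c)

  -- K_a lies on its own side of the separator.
  z-side-not-a : ∀ {r} → SideZ c r → holds op= a r ≡ false
  z-side-not-a hr = eq-test-other (λ r≡A → hr (cong (sep c) r≡A))

  old-leaves : ∀ {r s} → holds op= a r ≡ false → holds op= a s ≡ false → reach Na r ≡ reach Na s →
    reach OLD r ≡ reach OLD s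
  old-leaves ar as e = trans (child-reach op= a Ya Na ar) (trans (cong (false ∷_) e) (sym (child-reach op= a Ya Na as)))

  onA-leaves : ∀ r s → SideA c r → SideA c s → reach (onA c) r ≡ reach (onA c) s → r ≡ s ⊎ reach OLD r ≡ reach OLD s
  onA-leaves r s hr hs e with holds op= a r ≟ᵇ true | holds op= a s ≟ᵇ true
  ... | accept ar | accept as = inj₁ (trans (eq-test-key ar) (sym (eq-test-key as)))
  ... | accept ar | reject as = contradiction (G.isolatesA s hs (trans (sym e) (cong (reach (onA c)) (eq-test-key ar)))) as
  ... | reject ar | accept as = contradiction (G.isolatesA r hr (trans e (cong (reach (onA c)) (eq-test-key as)))) ar
  ... | reject ar | reject as = inj₂ (old-leaves (¬-not ar) (¬-not as) (G.faithfulA r s (¬-not ar) (¬-not as) hr hs e))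

  new-leaves : ∀ r s → reach NEW r ≡ reach NEW s → r ≡ s ⊎ reach OLD r ≡ reach OLD s
  new-leaves r s e with sep c r ≟ᵇ s₀ | sep c s ≟ᵇ s₀
  ... | accept hr | accept hs =
        onA-leaves r s hr hs (∷-injectiveʳ (trans (sym (NEW.side-reachˢ hr)) (trans e (NEW.side-reachˢ hs))))
  ... | reject hr | reject hs =
        inj₂ (old-leaves (z-side-not-a hr) (z-side-not-a hs)
               (G.faithfulZ r s hr hs (∷-injectiveʳ (trans (sym (NEW.side-reachᵒ hr)) (trans e (NEW.side-reachᵒ hs))))))
  ... | accept hr | reject hs =
        contradiction (∷-injectiveˡ (trans (sym (NEW.side-reachˢ hr)) (trans e (NEW.side-reachᵒ hs)))) (not-¬ refl)
  ... | reject hr | accept hs =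
        contradiction (∷-injectiveˡ (trans (sym (NEW.side-reachˢ hs)) (trans (sym e) (NEW.side-reachᵒ hr)))) (not-¬ refl)

  -- T′ is correct, because NEW only refines the leaves of OLD apart from isolating K_a.
  correct′ : Correct Q T′
  correct′ = sameLeaf⇒correct same
    where
    same : SameLeafSameRelation Q T′
    same r s qr qs e with reach-replace NEW atA r s e
    ... | inj₁ eT = correct⇒sameLeaf correctT r s qr qs eT
    ... | inj₂ (pr , ps , eN) with new-leaves r s eN
    ...   | inj₁ refl = λ _ → refl
    ...   | inj₂ eO   = correct⇒sameLeaf correctT r s qr qs
                          (trans (reach-at atA pr) (trans (cong (p ++_) eO) (sym (reach-at atA ps))))

  uses′ : UsesOnly C T′
  uses′ with G.allowed (uses-no (uses-at usesT atA))
  ... | uA , uZ , cs = uses-replace p usesT (node cs (uses-branch s₀ uA uZ) (uses-branch s₀ uZ uA))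

  -- The D extra comparisons charged to K_x.
  bonus : Fin n → Region n → ℕ
  bonus x r = if holds op= x r then D else 0

  bonus-on : ∀ x → bonus x (key x) ≡ D
  bonus-on x = cong (λ b → if b then D else 0) (eq-test-self x)

  bonus-off : ∀ x r → holds op= x r ≡ false → bonus x r ≡ 0
  bonus-off x r h = cong (λ b → if b then D else 0) h

  shallower : ∀ r → holds op= a r ≡ false → depth NEW r ≤ depth OLD r
  shallower r ar with sep c r ≟ᵇ s₀
  ... | accept hr = ≤-trans (≤-reflexive (NEW.side-depthˢ hr))
                      (≤-trans (s≤s (G.depthA r ar hr)) (≤-reflexive (sym (child-depth op= a Ya Na ar))))
  ... | reject hr = ≤-trans (≤-reflexive (NEW.side-depthᵒ hr))
                      (≤-trans (s≤s (G.depthZ r hr)) (≤-reflexive (sym (child-depth op= a Ya Na ar))))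

  a-not-z : holds op= a Z ≡ false
  a-not-z = eq-test-other {a = a} {r = Z} (λ Z≡A → contradiction (trans (sym z-not-a) (subst (λ x → holds op= z x ≡ true) Z≡A (eq-test-self z))) λ ())

  -- K_a moves D comparisons down, K_z at least D comparisons up.
  at-A : depth NEW A + bonus z A ≤ depth OLD A + bonus a A
  at-A = begin
    depth NEW A + bonus z A   ≡⟨ cong₂ _+_ (NEW.side-depthˢ refl) (bonus-off z A z-not-a) ⟩
    suc D + 0                 ≡⟨ ℕₚ.+-identityʳ (suc D) ⟩
    suc D                     ≤⟨ s≤s (m≤n+m D (depth Ya A)) ⟩
    suc (depth Ya A) + D      ≡⟨ cong₂ _+_ (sym (child-depth op= a Ya Na (eq-test-self a))) (sym (bonus-on a)) ⟩
    depth OLD A + bonus a A   ∎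
    where open ≤-Reasoning

  at-Z : depth NEW Z + bonus z Z ≤ depth OLD Z + bonus a Z
  at-Z = begin
    depth NEW Z + bonus z Z   ≡⟨ cong₂ _+_ (NEW.side-depthᵒ (G.separates ∘ sym)) (bonus-on z) ⟩
    suc (depth (onZ c) Z) + D ≡⟨ cong suc (ℕₚ.+-comm (depth (onZ c) Z) D) ⟩
    suc (D + depth (onZ c) Z) ≤⟨ s≤s G.budget ⟩
    suc (depth Na Z)          ≡⟨ sym (ℕₚ.+-identityʳ _) ⟩
    suc (depth Na Z) + 0      ≡⟨ cong₂ _+_ (sym (child-depth op= a Ya Na a-not-z)) (sym (bonus-off a Z a-not-z)) ⟩
    depth OLD Z + bonus a Z   ∎
    where open ≤-Reasoning

  new-depth : ∀ r → depth NEW r + bonus z r ≤ depth OLD r + bonus a r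
  new-depth r with holds op= a r ≟ᵇ true | holds op= z r ≟ᵇ true
  ... | accept ar | _         = subst (λ x → depth NEW x + bonus z x ≤ depth OLD x + bonus a x) (sym (eq-test-key ar)) at-A
  ... | reject _  | accept zr = subst (λ x → depth NEW x + bonus z x ≤ depth OLD x + bonus a x) (sym (eq-test-key zr)) at-Z
  ... | reject ar | reject zr =
        +-mono-≤ (shallower r (¬-not ar)) (≤-reflexive (trans (bonus-off z r (¬-not zr)) (sym (bonus-off a r (¬-not ar)))))

  -- Outside the replaced subtree nothing changes, and K_z is not there.
  outside : ∀ r → ¬ Passes T r p → bonus z r ≤ bonus a r
  outside r np with holds op= z r ≟ᵇ true
  ... | accept zr = contradiction (subst (λ x → Passes T x p) (sym (eq-test-key zr)) z-reaches-A) np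
  ... | reject zr = ≤-trans (≤-reflexive (bonus-off z r (¬-not zr))) z≤n

  per-region : ∀ r → depth T′ r + bonus z r ≤ depth T r + bonus a r
  per-region r = depth-replace NEW atA r (bonus z r) (bonus a r) (λ _ → new-depth r) (outside r)

  Σ-bonus : ∀ x → Σ (allRegions n) (λ r → bonus x r · w r) ≈ (D · w (key x))
  Σ-bonus x = ≈-trans (Σ-regions-single (λ r → bonus x r · w r) x (λ r r≢x → vanishes r (eq-test-other r≢x))) at-x
    where
    vanishes : ∀ r → holds op= x r ≡ false → (bonus x r · w r) ≈ 0#
    vanishes r h = ≈-reflexive (cong (_· w r) (bonus-off x r h))
    at-x : (bonus x (key x) · w (key x)) ≈ (D · w (key x))
    at-x = ≈-reflexive (cong (_· w (key x)) (bonus-on x))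

  cost-exchange : (cost w T′ ⊕ (D · w Z)) ≤ᶠ (cost w T ⊕ (D · w A))
  cost-exchange =
    ≲-respʳ-≈ (split T a) (≲-respˡ-≈ (split T′ z)
      (Σ-mono (λ r → ·-monoˡ (per-region r) (WithWeights.Distribution.nonneg dist r)) (allRegions n)))
    where
    split : ∀ S x → Σ (allRegions n) (λ r → (depth S r + bonus x r) · w r) ≈ (cost w S ⊕ (D · w (key x)))
    split S x = ≈-trans (Σ-multiplicities (depth S) (bonus x) w (allRegions n)) (⊕-cong ≈-refl (Σ-bonus x))

  -- Optimality of T:  cost T + D·β_z ≤ cost T′ + D·β_z ≤ cost T + D·β_a.
  β-order : w Z ≤ᶠ w A
  β-order = ·-cancel D G.a-tested
              (⊕-cancelˡ (≤ᶠ-trans (⊕-monoˡ (D · w Z) (proj₂ (proj₂ opt) T′ uses′ correct′)) cost-exchange))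

lemma1 : ∀ {c ℓ₁ ℓ₂ : Level} (F : OrderedCommRing c ℓ₁ ℓ₂) →
    ∀ {n : ℕ} (C : Op → Set) (Q : Region n → Set) (w : Region n → OrderedCommRing.Carrier F) →
    WithWeights.Distribution F Q w →
    (T : Tree n) → Irreducible Q T → WithWeights.Optimal F C Q w T →
    ∀ (p : List Bool) (b : Bool) (q : List Bool) (a z : Fin n) (Ya Na Yz Nz : Tree n) →
    T at p ≡ node op= a Ya Na →
    T at (p ++ (b ∷ q)) ≡ node op= z Yz Nz →
    OrderedCommRing._≤_ F (w (key z)) (w (key a))
lemma1 F C Q w dist T irr opt p b q a z Ya Na Yz Nz atA atZ with z ≟ᶠ a
... | accept refl = IsTotalOrder.refl (OrderedCommRing.isTotalOrder F)
... | reject z≢a  =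
  Exchange.β-order F C Q w dist T opt p a z Ya Na atA q Yz Nz Z-below-A z-in-Na (passes-prefix p z-visits) z-not-a
  where
  -- K_z reaches "v = K_z", so it passes "v = K_a" answering no and enters Na.
  z-visits : Passes T (key z) (p ++ b ∷ q)
  z-visits = irreducible-eq-visited (p ++ b ∷ q) irr atZ
  a-not-z : holds op= a (key z) ≡ false
  a-not-z = eq-test-other (z≢a ∘ key-injective)
  z-not-a : holds op= z (key a) ≡ false
  z-not-a = eq-test-other (z≢a ∘ sym ∘ key-injective)
  z-in-Na : Passes Na (key z) q
  z-in-Na = proj₁ (passes-no a-not-z (passes-after z-visits atA) (at-suffix atA atZ))
  Z-below-A : Na at q ≡ node op= z Yz Nz
  Z-below-A = proj₂ (passes-no a-not-z (passes-after z-visits atA) (at-suffix atA atZ))
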